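{- Let $X$ be the set of shuffle tableaux of shape $(\lambda/\mu)\circledast(\nu/\rho)$ with entries in $[N]$ flagged by a nondecreasing flag $\vec b$. Suppose $x\in X$ and $f_i(x)$ is a (nonzero) shuffle tableau with $f_i(x)\notin X$. Then the entry $i$ that is changed to $i+1$ by $f_i$ is the last (rightmost) entry of its row.
   Context: A shuffle tableau of shape $(\lambda/\mu)\circledast(\nu/\rho)$ ($n$ rows each) is a pair $(T,U)$ of semistandard tableaux of shapes $\lambda/\mu$, $\nu/\rho$; row $r$ of $T$ sits at level $2r-1$, row $r$ of $U$ at level $2r$ (a "row" is a row of $T$ or of $U$). Reading word: levels $2n,\dots,1$, each left to right. An $i$ in cell $(r,c)$ and $i+1$ in cell $(r+1,c)$ of the same tableau are column paired. $f_i$: remove column-paired $(i,i+1)$ pairs, bracket-match remaining $i$'s (")") and $i+1$'s ("("), and change the rightmost unmatched $i$ into $i+1$ ($0$ if none). Flagged by $\vec b=(b_1\le\dots\le b_{2n})$: entries at level $\ell$ are $\le b_\ell$. -}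

module Defs where

open import Data.Nat using (ℕ; zero; suc; _+_; _*_; _∸_; _≤_; _<_; _≟_; _≤?_; _<?_)
open import Data.Bool using (Bool; true; false; _∧_; if_then_else_)
open import Data.List using (List; []; _∷_; _++_; map; concatMap; upTo; downFrom)
open import Data.Maybe using (Maybe; just; nothing)
import Data.Maybe as Maybe
open import Data.Product using (_×_; _,_)
open import Relation.Nullary using (does)
open import Relation.Nullary.Decidable using (_×-dec_)

-- Rows are numbered 1..n, columns 1,2,... (English
-- convention: row r+1 lies below row r).  A partition / shape datum is
-- a function ℕ → ℕ of which only the values on rows 1..n matter.

-- The two tableaux of a shuffle tableau: 𝕋 (shape λ/μ), 𝕌 (shape ν/ρ).
data Side : Set where
  𝕋 𝕌 : Side

record Shape : Set where
  field
    n   : ℕ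
    lam : ℕ → ℕ
    mu  : ℕ → ℕ
    nu  : ℕ → ℕ
    rho : ℕ → ℕ
open Shape public

IsPartition : ℕ → (ℕ → ℕ) → Set
IsPartition n p = ∀ r → 1 ≤ r → r < n → p (suc r) ≤ p r

Contained : ℕ → (ℕ → ℕ) → (ℕ → ℕ) → Set
Contained n q p = ∀ r → 1 ≤ r → r ≤ n → q r ≤ p r

IsShape : Shape → Set
IsShape sh = IsPartition (n sh) (lam sh) × IsPartition (n sh) (mu sh)
           × IsPartition (n sh) (nu sh) × IsPartition (n sh) (rho sh)
           × Contained (n sh) (mu sh) (lam sh) × Contained (n sh) (rho sh) (nu sh)

outer : Shape → Side → ℕ → ℕ
outer sh 𝕋 = lam sh
outer sh 𝕌 = nu sh

inner : Shape → Side → ℕ → ℕ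
inner sh 𝕋 = mu sh
inner sh 𝕌 = rho sh

record Cell : Set where
  constructor cell
  field
    side : Side
    row  : ℕ
    col  : ℕ
open Cell public

InShape : Shape → Cell → Set
InShape sh κ = 1 ≤ row κ × row κ ≤ n sh
             × inner sh (side κ) (row κ) < col κ × col κ ≤ outer sh (side κ) (row κ)

inShapeᵇ : Shape → Cell → Bool
inShapeᵇ sh κ = does ((1 ≤? row κ) ×-dec ((row κ ≤? n sh)
               ×-dec ((inner sh (side κ) (row κ) <? col κ) ×-dec (col κ ≤? outer sh (side κ) (row κ)))))

level : Cell → ℕ
level (cell 𝕋 r c) = 2 * r ∸ 1
level (cell 𝕌 r c) = 2 * r

-- A filling of both shapes (values outside the cells are irrelevant).
ShuffleTab : Set
ShuffleTab = Side → ℕ → ℕ → ℕ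

entry : ShuffleTab → Cell → ℕ
entry x κ = x (side κ) (row κ) (col κ)

IsShuffleTableau : Shape → ShuffleTab → Set
IsShuffleTableau sh x =
    (∀ κ → InShape sh κ → 1 ≤ entry x κ)
  × (∀ s r c → InShape sh (cell s r c) → InShape sh (cell s r (suc c)) → x s r c ≤ x s r (suc c))
  × (∀ s r c → InShape sh (cell s r c) → InShape sh (cell s (suc r) c) → x s r c < x s (suc r) c)

FlagNondecreasing : Shape → (ℕ → ℕ) → Set
FlagNondecreasing sh b = ∀ ℓ → 1 ≤ ℓ → ℓ < 2 * n sh → b ℓ ≤ b (suc ℓ)

InX : Shape → ℕ → (ℕ → ℕ) → ShuffleTab → Set
InX sh N b x = IsShuffleTableau sh x
             × (∀ κ → InShape sh κ → entry x κ ≤ N)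
             × (∀ κ → InShape sh κ → entry x κ ≤ b (level κ))

rowCells : Shape → Side → ℕ → List Cell
rowCells sh s r = map (λ k → cell s r (suc (inner sh s r + k))) (upTo (outer sh s r ∸ inner sh s r))

readingWord : Shape → List Cell
readingWord sh = concatMap (λ r → rowCells sh 𝕌 r ++ rowCells sh 𝕋 r) (map suc (downFrom (n sh)))

_==_ : ℕ → ℕ → Bool
a == b = does (a ≟ b)

pairedDownᵇ : Shape → ℕ → ShuffleTab → Cell → Bool
pairedDownᵇ sh i x (cell s r c) = inShapeᵇ sh (cell s (suc r) c) ∧ (x s (suc r) c == suc i)

pairedUpᵇ : Shape → ℕ → ShuffleTab → Cell → Bool
pairedUpᵇ sh i x (cell s r c) = inShapeᵇ sh (cell s (r ∸ 1) c) ∧ (x s (r ∸ 1) c == i)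

-- bracket letters after removing column-paired pairs:
-- true = "(" (an i+1), false = ")" (an i)
brackets : Shape → ℕ → ShuffleTab → List Cell → List (Bool × Cell)
brackets sh i x [] = []
brackets sh i x (κ ∷ w) =
  if (entry x κ == i) ∧ (if pairedDownᵇ sh i x κ then false else true)
  then (false , κ) ∷ brackets sh i x w
  else (if (entry x κ == suc i) ∧ (if pairedUpᵇ sh i x κ then false else true)
        then (true , κ) ∷ brackets sh i x w
        else brackets sh i x w)

-- scan with the number of currently open "(" and the last unmatched ")"
lastUnmatched : ℕ → Maybe Cell → List (Bool × Cell) → Maybe Cell
lastUnmatched k acc [] = acc
lastUnmatched k acc ((true , κ) ∷ w) = lastUnmatched (suc k) acc w
lastUnmatched zero acc ((false , κ) ∷ w) = lastUnmatched zero (just κ) w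
lastUnmatched (suc k) acc ((false , κ) ∷ w) = lastUnmatched k acc w

-- the cell whose i is changed by f_i (nothing if f_i x = 0)
changed : Shape → ℕ → ShuffleTab → Maybe Cell
changed sh i x = lastUnmatched 0 nothing (brackets sh i x (readingWord sh))

sideEq : Side → Side → Bool
sideEq 𝕋 𝕋 = true
sideEq 𝕌 𝕌 = true
sideEq _ _ = false

setEntry : ShuffleTab → Cell → ℕ → ShuffleTab
setEntry x κ v s r c =
  if sideEq s (side κ) ∧ (r == row κ) ∧ (c == col κ) then v else x s r c

-- f_i ; nothing represents 0
f : Shape → ℕ → ShuffleTab → Maybe ShuffleTab
f sh i x = Maybe.map (λ κ → setEntry x κ (suc i)) (changed sh i x)

-- The changed cell κ gets the value i+1, and y agrees with x everywhere else. If κ had a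
-- right neighbour κ′ in its row, semistandardness of y would give i+1 ≤ y κ′ = x κ′; since
-- κ′ sits at the same level as κ, the bounds by N and by the flag that hold at κ′ in x then
-- hold at κ in y, so y would lie in X.
module Submission where

open import Defs
open import Data.Nat using (ℕ; _≤_)
open import Data.Maybe using (just; nothing)
open import Relation.Binary.PropositionalEquality using (_≡_)
open import Relation.Nullary using (¬_; contradiction)

open import Data.Nat using (suc; zero; _<_; _∸_; _+_; _≟_; s≤s; z≤n)
open import Data.Nat.Properties
  using (≤-trans; <⇒≤; m≤m+n; 1+n≢n; m<n⇒m<1+n; m≤n⇒m<n∨m≡n; m<n⇒n≢0; m∸n≢0⇒n<m; m≤o∸n⇒m+n≤o; +-comm; ≡ᵇ⇒≡)
open import Data.Bool using (true; false; T; _∧_; if_then_else_)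
open import Data.List using ([]; _∷_; _++_; map; downFrom)
open import Data.List.Membership.Propositional using (_∈_)
open import Data.List.Membership.Propositional.Properties
  using (∈-map⁻; ∈-concatMap⁻; ∈-++⁻; ∈-upTo⁻; ∈-downFrom⁻)
open import Data.List.Relation.Unary.All using (All; []; _∷_; tabulate)
open import Data.List.Relation.Unary.Any using (Any; here; there)
import Data.Maybe as Maybe
open import Data.Maybe.Properties using (just-injective)
import Data.Maybe.Relation.Unary.All as MaybeAll
open import Data.Product using (_×_; _,_; proj₂)
open import Data.Sum using (_⊎_; inj₁; inj₂)
open import Function using (_∘_)
open import Relation.Binary.PropositionalEquality using (refl; sym; trans; cong; subst; subst₂)
open import Relation.Nullary.Decidable using (dec-true)
open import Relation.Unary using (Pred)

rowCells-inShape : ∀ sh s r → 1 ≤ r → r ≤ n sh → ∀ {κ} → κ ∈ rowCells sh s r → InShape sh κ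
rowCells-inShape sh s r 1≤r r≤n κ∈row with k , k∈ , refl ← ∈-map⁻ _ κ∈row =
  1≤r , r≤n , s≤s (m≤m+n _ _) , subst (_≤ outer sh s r) (cong suc (+-comm k (inner sh s r))) k+inner<outer
  where
  k<width : k < outer sh s r ∸ inner sh s r
  k<width = ∈-upTo⁻ k∈
  k+inner<outer : suc k + inner sh s r ≤ outer sh s r
  k+inner<outer = m≤o∸n⇒m+n≤o (suc k) (<⇒≤ (m∸n≢0⇒n<m (m<n⇒n≢0 k<width))) k<width

readingWord-inShape : ∀ sh {κ} → κ ∈ readingWord sh → InShape sh κ
readingWord-inShape sh {κ} κ∈ = go (∈-concatMap⁻ _ {xs = map suc (downFrom (n sh))} κ∈) rowInRange
  where
  rowInRange : ∀ {r} → r ∈ map suc (downFrom (n sh)) → 1 ≤ r × r ≤ n sh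
  rowInRange r∈ with j , j∈ , refl ← ∈-map⁻ suc r∈ = s≤s z≤n , ∈-downFrom⁻ j∈
  go : ∀ {rs} → Any (λ r → κ ∈ rowCells sh 𝕌 r ++ rowCells sh 𝕋 r) rs
     → (∀ {r} → r ∈ rs → 1 ≤ r × r ≤ n sh) → InShape sh κ
  go {r ∷ _} (here κ∈rows) inRange with 1≤r , r≤n ← inRange (here refl) | ∈-++⁻ (rowCells sh 𝕌 r) κ∈rows
  ... | inj₁ κ∈U = rowCells-inShape sh 𝕌 r 1≤r r≤n κ∈U
  ... | inj₂ κ∈T = rowCells-inShape sh 𝕋 r 1≤r r≤n κ∈T
  go (there κ∈rest) inRange = go κ∈rest (inRange ∘ there)

brackets-all : ∀ {p} {P : Pred Cell p} sh i x w → All P w → All (P ∘ proj₂) (brackets sh i x w)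
brackets-all sh i x [] [] = []
brackets-all sh i x (κ ∷ w) (pκ ∷ pw)
  with (entry x κ == i) ∧ (if pairedDownᵇ sh i x κ then false else true)
... | true = pκ ∷ brackets-all sh i x w pw
... | false with (entry x κ == suc i) ∧ (if pairedUpᵇ sh i x κ then false else true)
...   | true  = pκ ∷ brackets-all sh i x w pw
...   | false = brackets-all sh i x w pw

lastUnmatched-all : ∀ {p} {P : Pred Cell p} k acc w
                  → MaybeAll.All P acc → All (P ∘ proj₂) w → MaybeAll.All P (lastUnmatched k acc w)
lastUnmatched-all k       acc []                pacc []        = pacc
lastUnmatched-all k       acc ((true  , κ) ∷ w) pacc (_ ∷ pw)  = lastUnmatched-all (suc k) acc w pacc pw
lastUnmatched-all zero    acc ((false , κ) ∷ w) _    (pκ ∷ pw) = lastUnmatched-all zero (just κ) w (MaybeAll.just pκ) pw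
lastUnmatched-all (suc k) acc ((false , κ) ∷ w) pacc (_ ∷ pw)  = lastUnmatched-all k acc w pacc pw

changed-inShape : ∀ sh i x {κ} → changed sh i x ≡ just κ → InShape sh κ
changed-inShape sh i x changed≡κ =
  MaybeAll.drop-just (subst (MaybeAll.All (InShape sh)) changed≡κ
    (lastUnmatched-all 0 nothing _ MaybeAll.nothing
      (brackets-all sh i x _ (tabulate (readingWord-inShape sh)))))

f-changed : ∀ sh i x {κ y} → changed sh i x ≡ just κ → f sh i x ≡ just y → setEntry x κ (suc i) ≡ y
f-changed sh i x changed≡κ fx≡y = just-injective (trans (sym (cong (Maybe.map _) changed≡κ)) fx≡y)

sideEq-sound : ∀ {s t} → sideEq s t ≡ true → s ≡ t
sideEq-sound {𝕋} {𝕋} _ = refl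
sideEq-sound {𝕌} {𝕌} _ = refl

sideEq-refl : ∀ s → sideEq s s ≡ true
sideEq-refl 𝕋 = refl
sideEq-refl 𝕌 = refl

==-sound : ∀ {m n} → (m == n) ≡ true → m ≡ n
==-sound {m} {n} m==n = ≡ᵇ⇒≡ m n (subst T (sym m==n) _)

entry-setEntry-self : ∀ x κ v → entry (setEntry x κ v) κ ≡ v
entry-setEntry-self x (cell s r c) v
  rewrite sideEq-refl s | dec-true (r ≟ r) refl | dec-true (c ≟ c) refl = refl

entry-setEntry : ∀ x κ v μ → μ ≡ κ ⊎ entry (setEntry x κ v) μ ≡ entry x μ
entry-setEntry x (cell s r c) v (cell s′ r′ c′)
  with sideEq s′ s in s′≡s | r′ == r in r′≡r | c′ == c in c′≡c
... | true  | true  | true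
    with refl ← sideEq-sound s′≡s | refl ← ==-sound {r′} r′≡r | refl ← ==-sound {c′} c′≡c = inj₁ refl
... | true  | true  | false = inj₂ refl
... | true  | false | _     = inj₂ refl
... | false | _     | _     = inj₂ refl

setEntry-bounded : ∀ sh x κ v (B : Cell → ℕ) → (∀ μ → InShape sh μ → entry x μ ≤ B μ) → v ≤ B κ
                 → ∀ μ → InShape sh μ → entry (setEntry x κ v) μ ≤ B μ
setEntry-bounded sh x κ v B x≤B v≤B μ μ∈ with entry-setEntry x κ v μ
... | inj₁ refl      = subst (_≤ B κ) (sym (entry-setEntry-self x κ v)) v≤B
... | inj₂ unchanged = subst (_≤ B μ) (sym unchanged) (x≤B μ μ∈)

level-cell : ∀ s r c c′ → level (cell s r c) ≡ level (cell s r c′)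
level-cell 𝕋 r c c′ = refl
level-cell 𝕌 r c c′ = refl

setEntry-inX : ∀ sh N b {x s r c v} → InX sh N b x
             → InShape sh (cell s r c) → InShape sh (cell s r (suc c))
             → IsShuffleTableau sh (setEntry x (cell s r c) v)
             → InX sh N b (setEntry x (cell s r c) v)
setEntry-inX sh N b {x} {s} {r} {c} {v} (_ , x≤N , x≤b) κ∈ κ′∈ yT@(_ , rowWeak , _) =
  yT , setEntry-bounded sh x κ v (λ _ → N) x≤N (≤-trans v≤xκ′ (x≤N κ′ κ′∈))
     , setEntry-bounded sh x κ v (b ∘ level) x≤b
         (subst (λ ℓ → v ≤ b ℓ) (level-cell s r (suc c) c) (≤-trans v≤xκ′ (x≤b κ′ κ′∈)))
  where
  κ κ′ : Cell
  κ  = cell s r c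
  κ′ = cell s r (suc c)
  κ′-unchanged : entry (setEntry x κ v) κ′ ≡ entry x κ′
  κ′-unchanged with entry-setEntry x κ v κ′
  ... | inj₁ κ′≡κ      = contradiction (cong col κ′≡κ) 1+n≢n
  ... | inj₂ unchanged = unchanged
  v≤xκ′ : v ≤ entry x κ′
  v≤xκ′ = subst₂ _≤_ (entry-setEntry-self x κ v) κ′-unchanged (rowWeak s r c κ∈ κ′∈)

lemma5p1 : (sh : Shape) → IsShape sh → (N : ℕ) → (b : ℕ → ℕ) → FlagNondecreasing sh b
           → (i : ℕ) → 1 ≤ i → (x y : ShuffleTab) → InX sh N b x
           → f sh i x ≡ just y → IsShuffleTableau sh y → ¬ InX sh N b y
           → (κ : Cell) → changed sh i x ≡ just κ
           → col κ ≡ outer sh (side κ) (row κ)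
lemma5p1 sh _ N b _ i _ x y x∈X fx≡y yT y∉X (cell s r c) changed≡κ
  with κ∈@(1≤r , r≤n , inner<c , c≤outer) ← changed-inShape sh i x changed≡κ
     | m≤n⇒m<n∨m≡n c≤outer
... | inj₂ c≡outer = c≡outer
... | inj₁ c<outer = contradiction (subst (InX sh N b) x′≡y x′∈X) y∉X
  where
  x′≡y : setEntry x (cell s r c) (suc i) ≡ y
  x′≡y = f-changed sh i x changed≡κ fx≡y
  κ′∈ : InShape sh (cell s r (suc c))
  κ′∈ = 1≤r , r≤n , m<n⇒m<1+n inner<c , c<outer
  x′∈X : InX sh N b (setEntry x (cell s r c) (suc i))
  x′∈X = setEntry-inX sh N b x∈X κ∈ κ′∈ (subst (IsShuffleTableau sh) (sym x′≡y) yT)
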